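{- Let $h$ be a positive integer and let $A$ be a finite set of $k$ positive integers. Then \[|h_{\pm}A| \geq 2(hk-h+1).\] Moreover, this lower bound is best possible for $h\leq 2$: for $h\in\{1,2\}$ and every positive integer $k$ there exists a set $A$ of $k$ positive integers with $|h_{\pm}A| = 2(hk-h+1)$ (for $h=1$ every such $A$ attains it, and for $h=2$ the set $A=\{1,3,5,\ldots,2k-1\}$ attains it).
   Context: For a finite set $A=\{a_0,a_1,\ldots,a_{k-1}\}$ of integers and a positive integer $h$, the $h$-fold signed sumset of $A$ is \[h_{\pm}A=\Big\{\sum_{i=0}^{k-1}\lambda_i a_i : (\lambda_0,\ldots,\lambda_{k-1})\in\mathbb{Z}^k,\ \sum_{i=0}^{k-1}|\lambda_i|=h\Big\}.\] -}

module Defs where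

open import Data.Nat using (ℕ; zero; suc)
import Data.Nat as ℕ
open import Data.Integer using (ℤ; +_; ∣_∣; _*_; _+_)
open import Data.Fin using (Fin; zero; suc)
open import Data.List using (List; length)
open import Data.List.Membership.Propositional using (_∈_)
open import Data.List.Relation.Unary.Unique.Propositional using (Unique)
open import Data.Product using (Σ; _×_; ∃)
open import Function.Bundles using (_⇔_)
open import Relation.Binary.PropositionalEquality using (_≡_)

sumℤ : ∀ {k} → (Fin k → ℤ) → ℤ
sumℤ {zero}  f = + 0
sumℤ {suc k} f = f zero + sumℤ (λ i → f (suc i))

sumℕ : ∀ {k} → (Fin k → ℕ) → ℕ
sumℕ {zero}  f = 0
sumℕ {suc k} f = f zero ℕ.+ sumℕ (λ i → f (suc i))

SignedSumset : ∀ {k} → ℕ → (Fin k → ℤ) → ℤ → Set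
SignedSumset {k} h a z =
  Σ (Fin k → ℤ) λ lam →
    (sumℕ (λ i → ∣ lam i ∣) ≡ h) × (sumℤ (λ i → lam i * a i) ≡ z)

HasCard : (ℤ → Set) → ℕ → Set
HasCard S n =
  Σ (List ℤ) λ L → Unique L × (∀ z → (z ∈ L) ⇔ S z) × (length L ≡ n)

-- Let 0 < x₀ < x₁ < ⋯ < x_{k-1} be the elements of A. The h(k-1)+1 integers
--   h x₀ < (h-1) x₀ + x₁ < ⋯ < x₀ + (h-1) x₁ < h x₁ < (h-1) x₁ + x₂ < ⋯ < h x_{k-1}
-- are positive and lie in h_±A, and so do their negatives: 2(hk-h+1) distinct elements.
-- For h = 1 the set is exactly ±A. For h = 2 every element is ±(aᵢ+aⱼ) or ±(aᵢ-aⱼ)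
-- with i ≠ j; for aᵢ = 2i+1 these are exactly the nonzero even numbers of absolute
-- value at most 4k-2.
module Submission where

open import Defs

module SignedSumsets where

  open import Data.Nat as ℕ using (ℕ; zero; suc; z≤n; s≤s; _∸_; _≤?_)
  import Data.Nat.Properties as ℕP
  import Data.Nat.Tactic.RingSolver as ℕSolver
  open import Data.Integer using (ℤ; +_; -_; -[1+_]; ∣_∣; _+_; _-_; _*_; _<_; _≤_; _≟_; +<+)
  import Data.Integer.Properties as ℤP
  open import Data.Integer.Tactic.RingSolver using (solve-∀)
  open import Data.Fin using (Fin; zero; suc; toℕ; fromℕ; fromℕ<)
  import Data.Fin.Properties as FinP
  import Data.Vec.Functional as Vector
  open import Data.Vec.Functional using (tail)
  open import Data.List
    using (List; []; _∷_; [_]; _++_; map; concatMap; upTo; allFin; length; deduplicate)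
  import Data.List.Properties as ListP
  open import Data.List.Membership.Propositional using (_∈_; find; lose)
  open import Data.List.Membership.Propositional.Properties
  open import Data.List.Relation.Binary.Subset.Propositional using (_⊆_)
  open import Data.List.Relation.Binary.Permutation.Propositional using (↭-sym; ↭⇒↭ₛ)
  import Data.List.Relation.Binary.Permutation.Propositional.Properties as PermP
  import Data.List.Relation.Binary.Permutation.Setoid.Properties as PermₛP
  open import Data.List.Relation.Unary.Any as Any using (here; there; _─_)
  open import Data.List.Relation.Unary.All as All using (All; []; _∷_)
  import Data.List.Relation.Unary.All.Properties as AllP
  open import Data.List.Relation.Unary.AllPairs as AllPairs using ([]; _∷_)
  open import Data.List.Relation.Unary.Linked using (Linked; []; [-]; _∷_)
  import Data.List.Relation.Unary.Linked.Properties as LinkedP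
  open import Data.List.Relation.Unary.Unique.Propositional using (Unique)
  import Data.List.Relation.Unary.Unique.Propositional.Properties as UniqueP
  import Data.List.Relation.Unary.Unique.DecPropositional.Properties _≟_ as DecUniqueP
  import Data.List.Sort ℤP.≤-decTotalOrder as Sort
  open import Data.Product using (Σ; ∃; ∃₂; _×_; _,_; uncurry)
  open import Data.Sum using (_⊎_; inj₁; inj₂)
  open import Data.Empty using (⊥-elim)
  open import Function using (_∘_)
  open import Function.Bundles using (mk⇔; Equivalence)
  open import Function.Definitions using (Injective)
  open import Relation.Binary.PropositionalEquality
    using (_≡_; _≢_; refl; sym; trans; cong; cong₂; subst; subst₂; setoid; module ≡-Reasoning)
  open import Relation.Binary.Definitions using (tri<; tri≈; tri>)
  open import Relation.Nullary using (¬_; yes; no)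

  *-suc∸+1 : ∀ h k → h ℕ.* suc k ∸ h ℕ.+ 1 ≡ suc (h ℕ.* k)
  *-suc∸+1 h k = begin
    h ℕ.* suc k ∸ h ℕ.+ 1     ≡⟨ cong (λ t → t ∸ h ℕ.+ 1) (ℕP.*-suc h k) ⟩
    h ℕ.+ h ℕ.* k ∸ h ℕ.+ 1   ≡⟨ cong (ℕ._+ 1) (ℕP.m+n∸m≡n h (h ℕ.* k)) ⟩
    h ℕ.* k ℕ.+ 1             ≡⟨ ℕP.+-comm (h ℕ.* k) 1 ⟩
    suc (h ℕ.* k)             ∎
    where open ≡-Reasoning

  infix 4 _≡±_
  _≡±_ : ℤ → ℤ → Set
  z ≡± w = z ≡ w ⊎ z ≡ - w

  ≡±-neg : ∀ {z w} → z ≡± - w → z ≡± w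
  ≡±-neg (inj₁ z≡-w) = inj₂ z≡-w
  ≡±-neg (inj₂ refl) = inj₁ (ℤP.neg-involutive _)

  ≡±-+ : ∀ {u v x y} → u ≡± x → v ≡± y → u + v ≡± x + y ⊎ u + v ≡± x - y
  ≡±-+ (inj₁ refl) (inj₁ refl) = inj₁ (inj₁ refl)
  ≡±-+ (inj₁ refl) (inj₂ refl) = inj₂ (inj₁ refl)
  ≡±-+ {x = x} {y} (inj₂ refl) (inj₁ refl) = inj₂ (inj₂ (swap x y))
    where
    swap : ∀ x y → - x + y ≡ - (x - y)
    swap = solve-∀
  ≡±-+ {x = x} {y} (inj₂ refl) (inj₂ refl) = inj₁ (inj₂ (sym (ℤP.neg-distrib-+ x y)))

  i*j≡±∣i∣*j : ∀ i j → i * j ≡± + ∣ i ∣ * j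
  i*j≡±∣i∣*j (+ n)    j = inj₁ refl
  i*j≡±∣i∣*j -[1+ n ] j = inj₂ (sym (ℤP.neg-distribˡ-* (+ suc n) j))

  module _ {k} (a : Fin (suc k) → ℤ) where

    signedSumset-cons : ∀ c {h h′ w z} → ∣ c ∣ ℕ.+ h′ ≡ h → c * a zero + w ≡ z →
                        SignedSumset h′ (tail a) w → SignedSumset h a z
    signedSumset-cons c refl refl (μ , refl , refl) = c Vector.∷ μ , refl , refl

    signedSumset-uncons : ∀ {h z} → SignedSumset h a z →
      Σ ℤ λ c → Σ ℕ λ h′ → Σ ℤ λ w →
        ∣ c ∣ ℕ.+ h′ ≡ h × c * a zero + w ≡ z × SignedSumset h′ (tail a) w
    signedSumset-uncons (μ , refl , refl) = μ zero , _ , _ , refl , refl , tail μ , refl , refl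

  signedSumset-zero : ∀ {k} (a : Fin k → ℤ) → SignedSumset 0 a (+ 0)
  signedSumset-zero {zero}  a = (λ ()) , refl , refl
  signedSumset-zero {suc k} a = signedSumset-cons a (+ 0) refl refl (signedSumset-zero (tail a))

  signedSumset-neg : ∀ {k h z} (a : Fin k → ℤ) → SignedSumset h a z → SignedSumset h a (- z)
  signedSumset-neg {zero} a (μ , h≡0 , refl) = μ , h≡0 , refl
  signedSumset-neg {suc k} a s with signedSumset-uncons a s
  ... | c , h′ , w , refl , refl , s′ =
    signedSumset-cons a (- c) (cong (ℕ._+ h′) (ℤP.∣-i∣≡∣i∣ c)) (neg-+ c (a zero) w)
      (signedSumset-neg (tail a) s′)
    where
    neg-+ : ∀ c x w → - c * x + - w ≡ - (c * x + w)
    neg-+ = solve-∀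

  signedSumset-scale : ∀ {k} (a : Fin k → ℤ) i p → SignedSumset p a (+ p * a i)
  signedSumset-scale a zero    p =
    signedSumset-cons a (+ p) (ℕP.+-identityʳ p) (ℤP.+-identityʳ _) (signedSumset-zero (tail a))
  signedSumset-scale a (suc i) p =
    signedSumset-cons a (+ 0) refl (ℤP.+-identityˡ _) (signedSumset-scale (tail a) i p)

  signedSumset-pair : ∀ {k} (a : Fin k → ℤ) i j p q →
                      SignedSumset (p ℕ.+ q) a (+ p * a i + + q * a j)
  signedSumset-pair a zero    zero    p q =
    signedSumset-cons a (+ (p ℕ.+ q)) (ℕP.+-identityʳ _)
      (trans (ℤP.+-identityʳ _) (ℤP.*-distribʳ-+ (a zero) (+ p) (+ q)))
      (signedSumset-zero (tail a))
  signedSumset-pair a zero    (suc j) p q =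
    signedSumset-cons a (+ p) refl refl (signedSumset-scale (tail a) j q)
  signedSumset-pair a (suc i) zero    p q =
    signedSumset-cons a (+ q) (ℕP.+-comm q p) (ℤP.+-comm (+ q * a zero) (+ p * a (suc i)))
      (signedSumset-scale (tail a) i p)
  signedSumset-pair a (suc i) (suc j) p q =
    signedSumset-cons a (+ 0) refl (ℤP.+-identityˡ _) (signedSumset-pair (tail a) i j p q)

  signedSumset₁⁺ : ∀ {k} (a : Fin k → ℤ) i → SignedSumset 1 a (a i)
  signedSumset₁⁺ a i = subst (SignedSumset 1 a) (ℤP.*-identityˡ (a i)) (signedSumset-scale a i 1)

  signedSumset₀⁻ : ∀ {k z} (a : Fin k → ℤ) → SignedSumset 0 a z → z ≡ + 0
  signedSumset₀⁻ {zero} a (_ , _ , refl) = refl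
  signedSumset₀⁻ {suc k} a s with signedSumset-uncons a s
  ... | + 0      , _ , w , refl , refl , s′ = trans (ℤP.+-identityˡ w) (signedSumset₀⁻ (tail a) s′)
  ... | + suc _  , _ , _ , () , _
  ... | -[1+ _ ] , _ , _ , () , _

  head-only : ∀ {k z w} (a : Fin (suc k) → ℤ) c → c * a zero + w ≡ z →
              SignedSumset 0 (tail a) w → z ≡± + ∣ c ∣ * a zero
  head-only a c refl s = subst (_≡± _) (sym c*x+w≡c*x) (i*j≡±∣i∣*j c (a zero))
    where
    c*x+w≡c*x = trans (cong (λ v → c * a zero + v) (signedSumset₀⁻ (tail a) s)) (ℤP.+-identityʳ _)

  signedSumset₁⁻ : ∀ {k z} (a : Fin k → ℤ) → SignedSumset 1 a z → ∃ λ i → z ≡± a i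
  signedSumset₁⁻ {zero} a (_ , () , _)
  signedSumset₁⁻ {suc k} a s with signedSumset-uncons a s
  ... | + 0 , _ , w , refl , refl , s′ =
    let j , w≡±aj = signedSumset₁⁻ (tail a) s′
    in  suc j , subst (_≡± a (suc j)) (sym (ℤP.+-identityˡ w)) w≡±aj
  ... | + 1      , _ , _ , refl , z≡ , s′ =
    zero , subst (_ ≡±_) (ℤP.*-identityˡ (a zero)) (head-only a (+ 1) z≡ s′)
  ... | -[1+ 0 ] , _ , _ , refl , z≡ , s′ =
    zero , subst (_ ≡±_) (ℤP.*-identityˡ (a zero)) (head-only a -[1+ 0 ] z≡ s′)
  ... | + suc (suc _) , _ , _ , () , _
  ... | -[1+ suc _ ]  , _ , _ , () , _

  SumOrDifference : ∀ {k} → (Fin k → ℤ) → ℤ → Set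
  SumOrDifference a z = (∃₂ λ i j → z ≡± a i + a j) ⊎ (∃₂ λ i j → i ≢ j × z ≡± a i - a j)

  module _ {k} (a : Fin (suc k) → ℤ) where

    sumOrDifference-tail : ∀ {w} → SumOrDifference (tail a) w →
                           SumOrDifference a (+ 0 * a zero + w)
    sumOrDifference-tail {w} (inj₁ (i , j , p)) =
      inj₁ (suc i , suc j , subst (_≡± _) (sym (ℤP.+-identityˡ w)) p)
    sumOrDifference-tail {w} (inj₂ (i , j , i≢j , p)) =
      inj₂ (suc i , suc j , i≢j ∘ FinP.suc-injective , subst (_≡± _) (sym (ℤP.+-identityˡ w)) p)

    sumOrDifference-unit : ∀ c {w} → c * a zero ≡± a zero → SignedSumset 1 (tail a) w →
                           SumOrDifference a (c * a zero + w)
    sumOrDifference-unit c c*x≡±x s with signedSumset₁⁻ (tail a) s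
    ... | j , w≡±aj with ≡±-+ c*x≡±x w≡±aj
    ...   | inj₁ p = inj₁ (zero , suc j , p)
    ...   | inj₂ p = inj₂ (zero , suc j , (λ ()) , p)

    sumOrDifference-double : ∀ {z} → z ≡± + 2 * a zero → SumOrDifference a z
    sumOrDifference-double p = inj₁ (zero , zero , subst (_ ≡±_) (two-* (a zero)) p)
      where
      two-* : ∀ x → + 2 * x ≡ x + x
      two-* = solve-∀

  signedSumset₂⁻ : ∀ {k z} (a : Fin k → ℤ) → SignedSumset 2 a z → SumOrDifference a z
  signedSumset₂⁻ {zero} a (_ , () , _)
  signedSumset₂⁻ {suc k} a s with signedSumset-uncons a s
  ... | + 0      , _ , _ , refl , refl , s′ = sumOrDifference-tail a (signedSumset₂⁻ (tail a) s′)
  ... | + 1      , _ , _ , refl , refl , s′ =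
    sumOrDifference-unit a (+ 1) (inj₁ (ℤP.*-identityˡ (a zero))) s′
  ... | -[1+ 0 ] , _ , _ , refl , refl , s′ =
    sumOrDifference-unit a -[1+ 0 ] (inj₂ (ℤP.-1*i≡-i (a zero))) s′
  ... | + 2      , _ , _ , refl , z≡ , s′ = sumOrDifference-double a (head-only a (+ 2) z≡ s′)
  ... | -[1+ 1 ] , _ , _ , refl , z≡ , s′ = sumOrDifference-double a (head-only a -[1+ 1 ] z≡ s′)
  ... | + suc (suc (suc _)) , _ , _ , () , _
  ... | -[1+ suc (suc _) ]  , _ , _ , () , _

  coefficients : ℕ → List ℤ
  coefficients h = map +_ (upTo (suc h)) ++ map -[1+_] (upTo h)

  ∈-coefficients⁺ : ∀ {h} c → ∣ c ∣ ℕ.≤ h → c ∈ coefficients h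
  ∈-coefficients⁺     (+ n)    n≤h = ∈-++⁺ˡ (∈-map⁺ +_ (∈-upTo⁺ (s≤s n≤h)))
  ∈-coefficients⁺ {h} -[1+ n ] n<h = ∈-++⁺ʳ (map +_ (upTo (suc h))) (∈-map⁺ -[1+_] (∈-upTo⁺ n<h))

  ∈-coefficients⁻ : ∀ {h c} → c ∈ coefficients h → ∣ c ∣ ℕ.≤ h
  ∈-coefficients⁻ {h} c∈ with ∈-++⁻ (map +_ (upTo (suc h))) c∈
  ... | inj₁ c∈+ with ∈-map⁻ +_ c∈+
  ...   | n , n∈ , refl = ℕP.≤-pred (∈-upTo⁻ n∈)
  ∈-coefficients⁻ {h} c∈ | inj₂ c∈- with ∈-map⁻ -[1+_] c∈-
  ...   | n , n∈ , refl = ∈-upTo⁻ n∈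

  signedSums : ∀ {k} → ℕ → (Fin k → ℤ) → List ℤ
  signedSumsWithHead : ∀ {k} → ℕ → (Fin (suc k) → ℤ) → ℤ → List ℤ

  signedSums {zero}  zero    a = [ + 0 ]
  signedSums {zero}  (suc h) a = []
  signedSums {suc k} h       a = concatMap (signedSumsWithHead h a) (coefficients h)

  signedSumsWithHead h a c = map (λ w → c * a zero + w) (signedSums (h ∸ ∣ c ∣) (tail a))

  ∈-signedSums⁺ : ∀ {k h z} (a : Fin k → ℤ) → SignedSumset h a z → z ∈ signedSums h a
  ∈-signedSums⁺ {zero} {zero}  a (_ , _ , refl) = here refl
  ∈-signedSums⁺ {zero} {suc h} a (_ , () , _)
  ∈-signedSums⁺ {suc k} a s with signedSumset-uncons a s
  ... | c , h′ , w , refl , refl , s′ =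
    ∈-concatMap⁺ (signedSumsWithHead _ a)
      (lose (∈-coefficients⁺ c (ℕP.m≤m+n ∣ c ∣ h′))
        (∈-map⁺ (λ w → c * a zero + w) (∈-signedSums⁺ (tail a) s″)))
    where
    s″ : SignedSumset (∣ c ∣ ℕ.+ h′ ∸ ∣ c ∣) (tail a) w
    s″ = subst (λ n → SignedSumset n (tail a) w) (sym (ℕP.m+n∸m≡n ∣ c ∣ h′)) s′

  ∈-signedSums⁻ : ∀ {k h z} (a : Fin k → ℤ) → z ∈ signedSums h a → SignedSumset h a z
  ∈-signedSums⁻ {zero} {zero} a (here refl) = (λ ()) , refl , refl
  ∈-signedSums⁻ {suc k} {h} a z∈
    with find (∈-concatMap⁻ (signedSumsWithHead h a) {xs = coefficients h} z∈)
  ... | c , c∈ , z∈′ with ∈-map⁻ (λ w → c * a zero + w) z∈′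
  ...   | w , w∈ , refl =
    signedSumset-cons a c (ℕP.m+[n∸m]≡n (∈-coefficients⁻ c∈)) refl (∈-signedSums⁻ (tail a) w∈)

  module _ {A : Set} where

    ∈-─ : ∀ {x z} {ys : List A} (x∈ys : x ∈ ys) → z ∈ ys → z ≢ x → z ∈ (ys ─ x∈ys)
    ∈-─ (here refl)  (here refl)  z≢x = ⊥-elim (z≢x refl)
    ∈-─ (here _)     (there z∈ys) _   = z∈ys
    ∈-─ (there _)    (here z≡y)   _   = here z≡y
    ∈-─ (there x∈ys) (there z∈ys) z≢x = there (∈-─ x∈ys z∈ys z≢x)

    unique⇒length-≤ : ∀ {xs ys : List A} → Unique xs → xs ⊆ ys → length xs ℕ.≤ length ys
    unique⇒length-≤ {[]}          _            _     = z≤n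
    unique⇒length-≤ {x ∷ xs} {ys} (x∉xs ∷ xs!) xs⊆ys =
      subst (suc (length xs) ℕ.≤_) (sym (ListP.length-removeAt′ ys (Any.index x∈ys)))
        (s≤s (unique⇒length-≤ xs! xs⊆ys─x))
      where
      x∈ys = xs⊆ys (here refl)
      xs⊆ys─x : xs ⊆ (ys ─ x∈ys)
      xs⊆ys─x z∈xs =
        ∈-─ x∈ys (xs⊆ys (there z∈xs)) (λ z≡x → All.lookup x∉xs z∈xs (sym z≡x))

  hasCard⇒length-≤ : ∀ {S n xs} → HasCard S n → Unique xs → All S xs → length xs ℕ.≤ n
  hasCard⇒length-≤ (ys , _ , ys≡S , refl) xs! xs⊆S =
    unique⇒length-≤ xs! (λ z∈xs → Equivalence.from (ys≡S _) (All.lookup xs⊆S z∈xs))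

  signedSumset-finite : ∀ {k} h (a : Fin k → ℤ) → ∃ λ n → HasCard (SignedSumset h a) n
  signedSumset-finite h a =
    _ , deduplicate _≟_ xs , DecUniqueP.deduplicate-! xs ,
    (λ z → mk⇔ (∈-signedSums⁻ a ∘ ∈-deduplicate⁻ _≟_ xs)
               (∈-deduplicate⁺ _≟_ ∘ ∈-signedSums⁺ a)) ,
    refl
    where xs = signedSums h a

  ±_ : List ℤ → List ℤ
  ± xs = xs ++ map -_ xs

  length-± : ∀ xs → length (± xs) ≡ 2 ℕ.* length xs
  length-± xs = trans (ListP.length-++ xs)
    (cong (length xs ℕ.+_) (trans (ListP.length-map -_ xs) (sym (ℕP.+-identityʳ _))))

  ±-unique : ∀ {xs} → All (+ 0 <_) xs → Unique xs → Unique (± xs)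
  ±-unique {xs} xs>0 xs! = UniqueP.++⁺ xs! (UniqueP.map⁺ ℤP.neg-injective xs!) disjoint
    where
    disjoint : ∀ {v} → ¬ (v ∈ xs × v ∈ map -_ xs)
    disjoint (v∈xs , v∈-xs) with ∈-map⁻ -_ v∈-xs
    ... | w , w∈xs , refl =
      ℤP.<-asym (ℤP.neg-mono-< (All.lookup xs>0 w∈xs)) (All.lookup xs>0 v∈xs)

  ∈-±⁺ : ∀ {x z xs} → x ∈ xs → z ≡± x → z ∈ ± xs
  ∈-±⁺           x∈xs (inj₁ refl) = ∈-++⁺ˡ x∈xs
  ∈-±⁺ {xs = xs} x∈xs (inj₂ refl) = ∈-++⁺ʳ xs (∈-map⁺ -_ x∈xs)

  ∈-±⁻ : ∀ {z xs} → z ∈ ± xs → ∃ λ x → x ∈ xs × z ≡± x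
  ∈-±⁻ {xs = xs} z∈ with ∈-++⁻ xs z∈
  ... | inj₁ z∈xs = _ , z∈xs , inj₁ refl
  ... | inj₂ z∈-xs with ∈-map⁻ -_ z∈-xs
  ...   | x , x∈xs , refl = x , x∈xs , inj₂ refl

  module _ {S : ℤ → Set} (S-neg : ∀ {z} → S z → S (- z)) where

    All-±⁺ : ∀ {xs} → All S xs → All S (± xs)
    All-±⁺ xs⊆S = All.tabulate λ z∈ →
      let x , x∈xs , z≡±x = ∈-±⁻ z∈ in closed z≡±x (All.lookup xs⊆S x∈xs)
      where
      closed : ∀ {z x} → z ≡± x → S x → S z
      closed (inj₁ refl) = λ s → s
      closed (inj₂ refl) = S-neg

    hasCard-± : ∀ xs → All (+ 0 <_) xs → Unique xs → All S xs →
                (∀ {z} → S z → ∃ λ x → x ∈ xs × z ≡± x) → HasCard S (2 ℕ.* length xs)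
    hasCard-± xs xs>0 xs! xs⊆S S⊆±xs =
      ± xs , ±-unique xs>0 xs! , (λ z → mk⇔ (All.lookup (All-±⁺ xs⊆S)) ±xs⊇S) , length-± xs
      where
      ±xs⊇S : ∀ {z} → S z → z ∈ ± xs
      ±xs⊇S s = let _ , x∈xs , z≡±x = S⊆±xs s in ∈-±⁺ x∈xs z≡±x

  StrictlyIncreasingFrom : ℤ → List ℤ → Set
  StrictlyIncreasingFrom b xs = ∀ {v} → v < b → Linked _<_ (v ∷ xs)

  positive-increasing⇒unique : ∀ {xs} → Linked _<_ (+ 0 ∷ xs) → All (+ 0 <_) xs × Unique xs
  positive-increasing⇒unique l with LinkedP.Linked⇒AllPairs ℤP.<-trans l
  ... | xs>0 ∷ xs↑ = xs>0 , AllPairs.map (λ x<y x≡y → ℤP.<-irrefl x≡y x<y) xs↑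

  staircase : ℤ → ℤ → ℕ → ℕ → List ℤ → List ℤ
  staircase x y zero    q rest = rest
  staircase x y (suc p) q rest = + suc p * x + + q * y ∷ staircase x y p (suc q) rest

  chain : ℕ → List ℤ → List ℤ
  chain h []          = []
  chain h (x ∷ [])    = [ + h * x ]
  chain h (x ∷ y ∷ r) = staircase x y h 0 (chain h (y ∷ r))

  length-staircase : ∀ x y p q rest → length (staircase x y p q rest) ≡ p ℕ.+ length rest
  length-staircase x y zero    q rest = refl
  length-staircase x y (suc p) q rest = cong suc (length-staircase x y p (suc q) rest)

  length-chain : ∀ h x r → length (chain h (x ∷ r)) ≡ suc (h ℕ.* length r)
  length-chain h x []      = cong suc (sym (ℕP.*-zeroʳ h))
  length-chain h x (y ∷ r) = begin
    length (staircase x y h 0 (chain h (y ∷ r)))   ≡⟨ length-staircase x y h 0 _ ⟩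
    h ℕ.+ length (chain h (y ∷ r))                 ≡⟨ cong (h ℕ.+_) (length-chain h y r) ⟩
    h ℕ.+ suc (h ℕ.* length r)                     ≡⟨ ℕP.+-suc h _ ⟩
    suc (h ℕ.+ h ℕ.* length r)                     ≡⟨ cong suc (ℕP.*-suc h (length r)) ⟨
    suc (h ℕ.* suc (length r))                     ∎
    where open ≡-Reasoning

  staircase-increasing : ∀ {x y rest} → x < y → ∀ p q →
    StrictlyIncreasingFrom (+ (p ℕ.+ q) * y) rest →
    StrictlyIncreasingFrom (+ p * x + + q * y) (staircase x y p q rest)
  staircase-increasing x<y zero q rest↑ v< = rest↑ (subst (_ <_) (ℤP.+-identityˡ _) v<)
  staircase-increasing {x} {y} {rest} x<y (suc p) q rest↑ v< =
    v< ∷ staircase-increasing x<y p (suc q) rest↑′ step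
    where
    rest↑′ : StrictlyIncreasingFrom (+ (p ℕ.+ suc q) * y) rest
    rest↑′ = subst (λ n → StrictlyIncreasingFrom (+ n * y) rest) (sym (ℕP.+-suc p q)) rest↑
    shift-x : ∀ P Q x y → (+ 1 + P) * x + Q * y ≡ (P * x + Q * y) + x
    shift-x = solve-∀
    shift-y : ∀ P Q x y → P * x + (+ 1 + Q) * y ≡ (P * x + Q * y) + y
    shift-y = solve-∀
    step : + suc p * x + + q * y < + p * x + + suc q * y
    step = subst₂ _<_ (sym (shift-x (+ p) (+ q) x y)) (sym (shift-y (+ p) (+ q) x y))
             (ℤP.+-monoʳ-< (+ p * x + + q * y) x<y)

  chain-increasing : ∀ h {x r} → Linked _<_ (x ∷ r) →
                     StrictlyIncreasingFrom (+ h * x) (chain h (x ∷ r))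
  chain-increasing h {r = []}    _             v< = v< ∷ [-]
  chain-increasing h {r = y ∷ r} (x<y ∷ y∷r↑) v< =
    staircase-increasing x<y h 0 tail↑ (subst (_ <_) (sym (ℤP.+-identityʳ _)) v<)
    where
    tail↑ : StrictlyIncreasingFrom (+ (h ℕ.+ 0) * y) (chain h (y ∷ r))
    tail↑ = subst (λ n → StrictlyIncreasingFrom (+ n * y) (chain h (y ∷ r)))
              (sym (ℕP.+-identityʳ h)) (chain-increasing h y∷r↑)

  module _ {k} (a : Fin k → ℤ) where

    values : List ℤ
    values = map a (allFin k)

    length-values : length values ≡ k
    length-values = trans (ListP.length-map a (allFin k)) (ListP.length-tabulate (λ i → i))

    Value : ℤ → Set
    Value x = ∃ λ i → a i ≡ x

    staircase-⊆ : ∀ i j p q {n rest} → p ℕ.+ q ≡ n → All (SignedSumset n a) rest →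
                  All (SignedSumset n a) (staircase (a i) (a j) p q rest)
    staircase-⊆ i j zero    q refl rest⊆ = rest⊆
    staircase-⊆ i j (suc p) q refl rest⊆ =
      signedSumset-pair a i j (suc p) q ∷ staircase-⊆ i j p (suc q) (ℕP.+-suc p q) rest⊆

    chain-⊆ : ∀ h {xs} → All Value xs → All (SignedSumset h a) (chain h xs)
    chain-⊆ h []                               = []
    chain-⊆ h ((i , refl) ∷ [])                = signedSumset-scale a i h ∷ []
    chain-⊆ h ((i , refl) ∷ (j , refl) ∷ xs⊆a) =
      staircase-⊆ i j h 0 (ℕP.+-identityʳ h) (chain-⊆ h ((j , refl) ∷ xs⊆a))

    sortedValues : Injective _≡_ _≡_ a →
                   Σ (List ℤ) λ xs → Linked _<_ xs × length xs ≡ k × All Value xs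
    sortedValues a-inj = xs , strictify (Sort.sort-↗ values) xs! , length-xs , xs⊆a
      where
      xs = Sort.sort values
      xs! : Unique xs
      xs! = PermₛP.Unique-resp-↭ (setoid ℤ) (↭⇒↭ₛ (↭-sym (Sort.sort-↭ values)))
              (UniqueP.map⁺ a-inj (UniqueP.allFin⁺ k))
      length-xs : length xs ≡ k
      length-xs = trans (PermP.↭-length (Sort.sort-↭ values)) length-values
      xs⊆a : All Value xs
      xs⊆a = All.tabulate λ x∈xs →
        let i , _ , x≡ai = ∈-map⁻ a (PermP.∈-resp-↭ (Sort.sort-↭ values) x∈xs) in i , sym x≡ai
      strictify : ∀ {ys} → Linked _≤_ ys → Unique ys → Linked _<_ ys
      strictify []          _                 = []
      strictify [-]         _                 = [-]
      strictify (y≤z ∷ ys↗) ((y≢z ∷ _) ∷ ys!) = ℤP.≤∧≢⇒< y≤z y≢z ∷ strictify ys↗ ys!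

    card-signedSumset₁ : Injective _≡_ _≡_ a → (∀ i → + 0 < a i) →
                         HasCard (SignedSumset 1 a) (2 ℕ.* k)
    card-signedSumset₁ a-inj a>0 =
      subst (λ m → HasCard (SignedSumset 1 a) (2 ℕ.* m)) length-values
        (hasCard-± (signedSumset-neg a) values (AllP.map⁺ (AllP.tabulate⁺ a>0))
          (UniqueP.map⁺ a-inj (UniqueP.allFin⁺ k))
          (AllP.map⁺ (AllP.tabulate⁺ (signedSumset₁⁺ a))) values-cover)
      where
      values-cover : ∀ {z} → SignedSumset 1 a z → ∃ λ x → x ∈ values × z ≡± x
      values-cover s = let i , z≡±ai = signedSumset₁⁻ a s in a i , ∈-map⁺ a (∈-allFin i) , z≡±ai

  card-signedSumset-≥ : ∀ {h k n} (a : Fin (suc k) → ℤ) → Injective _≡_ _≡_ a →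
                        (∀ i → + 0 < a i) → HasCard (SignedSumset (suc h) a) n →
                        2 ℕ.* suc (suc h ℕ.* k) ℕ.≤ n
  card-signedSumset-≥ {h} {n = n} a a-inj a>0 card with sortedValues a a-inj
  ... | x ∷ r , x∷r↑ , refl , xs⊆a@((i , refl) ∷ _) =
    subst (ℕ._≤ n) (trans (length-± P) (cong (2 ℕ.*_) (length-chain (suc h) x r)))
      (hasCard⇒length-≤ card (uncurry ±-unique (positive-increasing⇒unique P↑))
        (All-±⁺ (signedSumset-neg a) (chain-⊆ a (suc h) xs⊆a)))
    where
    P = chain (suc h) (x ∷ r)
    hx>0 : + 0 < + suc h * x
    hx>0 = subst (_< + suc h * x) (ℤP.*-zeroʳ (+ suc h)) (ℤP.*-monoˡ-<-pos (+ suc h) (a>0 i))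
    P↑ : Linked _<_ (+ 0 ∷ P)
    P↑ = chain-increasing (suc h) x∷r↑ hx>0

  odds : ∀ {k} → Fin k → ℤ
  odds i = + (2 ℕ.* toℕ i ℕ.+ 1)

  odds-sum : ∀ {k} (i j : Fin k) → odds i + odds j ≡ + (2 ℕ.* suc (toℕ i ℕ.+ toℕ j))
  odds-sum i j = cong +_ (sum (toℕ i) (toℕ j))
    where
    sum : ∀ m n → 2 ℕ.* m ℕ.+ 1 ℕ.+ (2 ℕ.* n ℕ.+ 1) ≡ 2 ℕ.* suc (m ℕ.+ n)
    sum = ℕSolver.solve-∀

  odds-diff : ∀ {k} (i j : Fin k) d → suc (toℕ j ℕ.+ d) ≡ toℕ i →
              odds i - odds j ≡ + (2 ℕ.* suc d)
  odds-diff i j d eq = begin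
    + (2 ℕ.* toℕ i ℕ.+ 1) - oj                ≡⟨ cong (λ t → + (2 ℕ.* t ℕ.+ 1) - oj) (sym eq) ⟩
    + (2 ℕ.* suc (toℕ j ℕ.+ d) ℕ.+ 1) - oj    ≡⟨ cong (λ t → + t - oj) (shift (toℕ j) d) ⟩
    oj + + (2 ℕ.* suc d) - oj                 ≡⟨ cancel oj (+ (2 ℕ.* suc d)) ⟩
    + (2 ℕ.* suc d)                           ∎
    where
    open ≡-Reasoning
    oj = odds j
    shift : ∀ m d → 2 ℕ.* suc (m ℕ.+ d) ℕ.+ 1 ≡ 2 ℕ.* m ℕ.+ 1 ℕ.+ 2 ℕ.* suc d
    shift = ℕSolver.solve-∀
    cancel : ∀ x y → x + y - x ≡ y
    cancel = solve-∀

  halves : ∀ {k m} → m ℕ.≤ k ℕ.+ k → ∃₂ λ (i j : Fin (suc k)) → toℕ i ℕ.+ toℕ j ≡ m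
  halves {k} {m} m≤k+k with m ≤? k
  ... | yes m≤k = fromℕ< (s≤s m≤k) , zero , trans (ℕP.+-identityʳ _) (FinP.toℕ-fromℕ< (s≤s m≤k))
  ... | no  m≰k = fromℕ k , fromℕ< (s≤s m∸k≤k) ,
      trans (cong₂ ℕ._+_ (FinP.toℕ-fromℕ k) (FinP.toℕ-fromℕ< (s≤s m∸k≤k))) (ℕP.m+[n∸m]≡n k≤m)
    where
    k≤m : k ℕ.≤ m
    k≤m = ℕP.<⇒≤ (ℕP.≰⇒> m≰k)
    m∸k≤k : m ∸ k ℕ.≤ k
    m∸k≤k = ℕP.≤-trans (ℕP.∸-monoˡ-≤ k m≤k+k) (ℕP.≤-reflexive (ℕP.m+n∸m≡n k k))

  module _ (k : ℕ) where

    evens : List ℤ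
    evens = map (λ m → + (2 ℕ.* suc m)) (upTo (suc (k ℕ.+ k)))

    ∈-evens⁺ : ∀ {z} m → m ℕ.≤ k ℕ.+ k → z ≡± + (2 ℕ.* suc m) →
               ∃ λ x → x ∈ evens × z ≡± x
    ∈-evens⁺ m m≤k+k z≡± = _ , ∈-map⁺ _ (∈-upTo⁺ (s≤s m≤k+k)) , z≡±

    difference-bound : ∀ (i j : Fin (suc k)) d → suc (toℕ i ℕ.+ d) ≡ toℕ j → d ℕ.≤ k ℕ.+ k
    difference-bound i j d eq = begin
      d                  ≤⟨ ℕP.m≤n+m d (suc (toℕ i)) ⟩
      suc (toℕ i ℕ.+ d)  ≡⟨ eq ⟩
      toℕ j              ≤⟨ FinP.toℕ≤pred[n] j ⟩
      k                  ≤⟨ ℕP.m≤m+n k k ⟩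
      k ℕ.+ k            ∎
      where open ℕP.≤-Reasoning

    difference-cover : ∀ {z} (i j : Fin (suc k)) → i ≢ j → z ≡± odds i - odds j →
                       ∃ λ x → x ∈ evens × z ≡± x
    difference-cover i j i≢j z≡± with ℕP.<-cmp (toℕ i) (toℕ j)
    ... | tri≈ _ i≡j _ = ⊥-elim (i≢j (FinP.toℕ-injective i≡j))
    ... | tri> _ _ j<i = let d , eq = ℕP.m≤n⇒∃[o]m+o≡n j<i in
      ∈-evens⁺ d (difference-bound j i d eq) (subst (_ ≡±_) (odds-diff i j d eq) z≡±)
    ... | tri< i<j _ _ = let d , eq = ℕP.m≤n⇒∃[o]m+o≡n i<j in
      ∈-evens⁺ d (difference-bound i j d eq)
        (≡±-neg (subst (_ ≡±_) (trans (antisym (odds i) (odds j)) (cong -_ (odds-diff j i d eq))) z≡±))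
      where
      antisym : ∀ x y → x - y ≡ - (y - x)
      antisym = solve-∀

    card-signedSumset₂-odds : HasCard (SignedSumset 2 (odds {suc k})) (2 ℕ.* suc (k ℕ.+ k))
    card-signedSumset₂-odds =
      subst (λ m → HasCard (SignedSumset 2 (odds {suc k})) (2 ℕ.* m)) length-evens
        (hasCard-± (signedSumset-neg (odds {suc k})) evens evens>0 evens! evens⊆ evens-cover)
      where
      n = suc (k ℕ.+ k)
      length-evens : length evens ≡ n
      length-evens = trans (ListP.length-map _ (upTo n)) (ListP.length-upTo n)
      evens>0 : All (+ 0 <_) evens
      evens>0 = AllP.map⁺ (All.tabulate {xs = upTo n} (λ {m} _ → +<+ {n = 2 ℕ.* suc m} (s≤s z≤n)))
      evens! : Unique evens
      evens! = UniqueP.map⁺ (ℕP.suc-injective ∘ ℕP.*-cancelˡ-≡ (suc _) (suc _) 2 ∘ ℤP.+-injective)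
                 (UniqueP.upTo⁺ n)
      sum-of-two : ∀ {m} → m ℕ.≤ k ℕ.+ k → SignedSumset 2 (odds {suc k}) (+ (2 ℕ.* suc m))
      sum-of-two m≤k+k with halves m≤k+k
      ... | i , j , i+j≡m = subst (SignedSumset 2 (odds {suc k}))
        (trans (cong₂ _+_ (ℤP.*-identityˡ (odds i)) (ℤP.*-identityˡ (odds j)))
          (trans (odds-sum i j) (cong (λ t → + (2 ℕ.* suc t)) i+j≡m)))
        (signedSumset-pair (odds {suc k}) i j 1 1)
      evens⊆ : All (SignedSumset 2 (odds {suc k})) evens
      evens⊆ = AllP.map⁺ (All.tabulate (λ m∈ → sum-of-two (ℕP.≤-pred (∈-upTo⁻ m∈))))
      evens-cover : ∀ {z} → SignedSumset 2 (odds {suc k}) z → ∃ λ x → x ∈ evens × z ≡± x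
      evens-cover {z} s with signedSumset₂⁻ (odds {suc k}) s
      ... | inj₁ (i , j , z≡±) =
        ∈-evens⁺ (toℕ i ℕ.+ toℕ j) (ℕP.+-mono-≤ (FinP.toℕ≤pred[n] i) (FinP.toℕ≤pred[n] j))
          (subst (z ≡±_) (odds-sum i j) z≡±)
      ... | inj₂ (i , j , i≢j , z≡±) = difference-cover i j i≢j z≡±

open SignedSumsets
  using (*-suc∸+1; signedSumset-finite; card-signedSumset-≥; card-signedSumset₁; card-signedSumset₂-odds)

open import Data.Nat using (ℕ; suc; _≤_; _*_; _+_; _∸_)
import Data.Nat.Properties as ℕP
open import Data.Integer using (ℤ; +_) renaming (_<_ to _<ℤ_)
open import Data.Fin using (Fin; toℕ)
open import Data.Product using (Σ; _×_; _,_)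
open import Function.Definitions using (Injective)
open import Relation.Binary.PropositionalEquality using (_≡_; sym; trans; cong; subst)

theorem1 :
    -- lower bound: for h ≥ 1 and any set A of k ≥ 1 positive integers
    ((h k : ℕ) → 1 ≤ h → 1 ≤ k → (a : Fin k → ℤ) → Injective _≡_ _≡_ a →
       (∀ i → + 0 <ℤ a i) →
       Σ ℕ λ n → HasCard (SignedSumset h a) n × (2 * (h * k ∸ h + 1) ≤ n))
    ×
    -- h = 1: every set A of k positive integers attains the bound 2k
    ((k : ℕ) → 1 ≤ k → (a : Fin k → ℤ) → Injective _≡_ _≡_ a →
       (∀ i → + 0 <ℤ a i) →
       HasCard (SignedSumset 1 a) (2 * (1 * k ∸ 1 + 1)))
    ×
    -- h = 2: A = {1,3,...,2k-1} attains the bound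
    ((k : ℕ) → 1 ≤ k →
       HasCard (SignedSumset 2 (λ (i : Fin k) → + (2 * toℕ i + 1)))
               (2 * (2 * k ∸ 2 + 1)))
theorem1 =
  (λ { (suc h) (suc k) _ _ a a-inj a>0 →
         let n , card = signedSumset-finite (suc h) a in
         n , card , subst (λ m → 2 * m ≤ n) (sym (*-suc∸+1 (suc h) k))
                      (card-signedSumset-≥ a a-inj a>0 card)
     ; 0 _ () ; (suc _) 0 _ () }) ,
  (λ { (suc k) _ a a-inj a>0 →
         subst (λ m → HasCard (SignedSumset 1 a) (2 * m))
           (sym (trans (*-suc∸+1 1 k) (cong suc (ℕP.*-identityˡ k))))
           (card-signedSumset₁ a a-inj a>0)
     ; 0 () }) ,
  (λ { (suc k) _ →
         subst (λ m → HasCard (SignedSumset 2 (λ (i : Fin (suc k)) → + (2 * toℕ i + 1))) (2 * m))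
           (sym (trans (*-suc∸+1 2 k) (cong (λ t → suc (k + t)) (ℕP.+-identityʳ k))))
           (card-signedSumset₂-odds k)
     ; 0 () })
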